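{- For $t\in\{6,10\}$ and all sufficiently large $X$, \[ \#\{n\le X:\ b_t(n)\text{ is even}\}\gg \sqrt{X}. \]
   Context: For an integer $t\ge 2$, $b_t(n)$ is the number of partitions of $n$ none of whose parts is divisible by $t$; equivalently $\sum_{n\ge0}b_t(n)q^n=f_t/f_1$ with $f_k=\prod_{j\ge1}(1-q^{jk})$. Here $n$ ranges over nonnegative integers and $\gg$ means bounded below by a positive constant times the right-hand side. -}

module Defs where

open import Data.Nat using (ℕ; zero; suc; _+_; _*_; _∸_; _≤?_; _%_)
open import Data.Nat.Properties using (_≟_)
open import Data.Nat.Divisibility using (_∣?_)
open import Data.List using (List; []; _∷_; _++_; map; concat; length; filter; upTo; replicate)
open import Relation.Nullary using (yes; no)

-- partsUpTo t k n : the list of all partitions of n (as nonincreasing lists of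
-- positive parts) whose parts are all ≤ k and none of which is divisible by t.
partsUpTo : ℕ → ℕ → ℕ → List (List ℕ)
partsUpTo t zero zero = [] ∷ []
partsUpTo t zero (suc n) = []
partsUpTo t (suc j) n with t ∣? suc j
... | yes _ = partsUpTo t j n
... | no _ = concat (map choose (upTo (suc n)))
  where
  choose : ℕ → List (List ℕ)
  choose m with m * suc j ≤? n
  ... | yes _ = map (replicate m (suc j) ++_) (partsUpTo t j (n ∸ m * suc j))
  ... | no _ = []

b : ℕ → ℕ → ℕ
b t n = length (partsUpTo t n n)

evenCount : ℕ → ℕ → ℕ
evenCount t X = length (filter (λ n → b t n % 2 ≟ 0) (upTo (suc X)))

{-# OPTIONS --safe #-}
module Submission where

-- Modulo 2, (f_t / f_1) · f_1 = f_t is a series in q^t, and by Euler's pentagonal number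
-- theorem f_1 ≡ ∏ (1 + q^k) ≡ ∑ q^ω over the generalized pentagonal numbers ω. So for t ∤ n
-- the sum of b_t(n - ω) over the pentagonal ω ≤ n is even. For n in a window
-- ω⁺ m ≤ n < ω⁻ (m + 1) that sum has 2m + 1 terms, so one of them, b_t(n - ω), is even.
-- The windows below ω⁻ (K + 1) ≤ X + 1 contain at least K(K + 1)/2 non-multiples of t,
-- and each even value b_t(y) is reached from at most 2K + 1 of them, so at least
-- K(K + 1) / (2(2K + 1)) ≫ √X values b_t(y) with y ≤ X are even.

open import Defs
open import Data.Nat
  using (ℕ; zero; suc; _+_; _*_; _∸_; _≤_; _<_; _≤′_; ≤′-refl; ≤′-step; z≤n; s≤s; _≤?_; _<?_; _%_; parity)
open import Data.Nat.Properties
open import Data.Nat.Divisibility using (_∣_; _∣?_; divides; ∣m∣n⇒∣m+n; ∣m+n∣m⇒∣n; ∣1⇒≡1)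
open import Data.Nat.Tactic.RingSolver using (solve-∀)
open import Data.Parity.Base as ℙ using (Parity; 0ℙ; 1ℙ)
import Data.Parity.Properties as ℙ
open import Data.Product using (∃; _×_; _,_)
open import Data.Sum using (_⊎_; inj₁; inj₂)
open import Data.List using (List; _∷_; _++_; map; concat; length; applyUpTo; filter; replicate)
open import Data.List.Properties using (length-++; length-map)
open import Data.Empty using (⊥-elim)
open import Relation.Nullary using (¬_; ¬?; Dec; yes; no)
open import Relation.Binary.PropositionalEquality
  using (_≡_; refl; sym; trans; cong; cong₂; subst; module ≡-Reasoning)
open import Algebra.Bundles using (AbelianGroup)
open import Level using (0ℓ)
import Algebra.Construct.Pointwise ℕ as Pointwise
import Relation.Binary.Reasoning.Setoid as SetoidReasoning
open import Algebra.Properties.CommutativeSemigroup +-commutativeSemigroup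
  using () renaming (interchange to +-interchange)

mono-from-steps : ∀ (f : ℕ → ℕ) → (∀ k → f k ≤ f (suc k)) → ∀ {m k} → m ≤ k → f m ≤ f k
mono-from-steps f step {m} m≤k = go (≤⇒≤′ m≤k)
  where
  go : ∀ {k} → m ≤′ k → f m ≤ f k
  go ≤′-refl         = ≤-refl
  go (≤′-step m≤′k) = ≤-trans (go m≤′k) (step _)

infix 10 ∑<
∑< : ℕ → (ℕ → ℕ) → ℕ
∑< zero    f = 0
∑< (suc k) f = ∑< k f + f k

syntax ∑< k (λ i → e) = ∑[ i < k ] e

∑-cong : ∀ {f g} k → (∀ i → i < k → f i ≡ g i) → ∑< k f ≡ ∑< k g
∑-cong zero    f≡g = refl
∑-cong (suc k) f≡g = cong₂ _+_ (∑-cong k (λ i i<k → f≡g i (m≤n⇒m≤1+n i<k))) (f≡g k ≤-refl)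

∑-zero : ∀ {f} k → (∀ i → i < k → f i ≡ 0) → ∑< k f ≡ 0
∑-zero zero    f≡0 = refl
∑-zero (suc k) f≡0 = cong₂ _+_ (∑-zero k (λ i i<k → f≡0 i (m≤n⇒m≤1+n i<k))) (f≡0 k ≤-refl)

∑-mono : ∀ {f g} k → (∀ i → i < k → f i ≤ g i) → ∑< k f ≤ ∑< k g
∑-mono zero    f≤g = z≤n
∑-mono (suc k) f≤g = +-mono-≤ (∑-mono k (λ i i<k → f≤g i (m≤n⇒m≤1+n i<k))) (f≤g k ≤-refl)

∑-+ : ∀ f g k → ∑[ i < k ] (f i + g i) ≡ ∑< k f + ∑< k g
∑-+ f g zero    = refl
∑-+ f g (suc k) = trans (cong (_+ (f k + g k)) (∑-+ f g k)) (+-interchange (∑< k f) (∑< k g) (f k) (g k))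

∑-head : ∀ f k → ∑< (suc k) f ≡ f 0 + ∑[ i < k ] f (suc i)
∑-head f zero    = +-comm 0 (f 0)
∑-head f (suc k) = trans (cong (_+ f (suc k)) (∑-head f k)) (+-assoc (f 0) _ _)

∑-split : ∀ f a d → ∑< (a + d) f ≡ ∑< a f + ∑[ i < d ] f (a + i)
∑-split f a zero    = trans (cong (λ k → ∑< k f) (+-identityʳ a)) (sym (+-identityʳ _))
∑-split f a (suc d) = trans (cong (λ k → ∑< k f) (+-suc a d))
                            (trans (cong (_+ f (a + d)) (∑-split f a d)) (+-assoc (∑< a f) _ _))

∑-monoˡ : ∀ f {k k′} → k ≤ k′ → ∑< k f ≤ ∑< k′ f
∑-monoˡ f = mono-from-steps (λ k → ∑< k f) (λ k → m≤m+n (∑< k f) (f k))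

length-concat-applyUpTo : ∀ {A : Set} {f : ℕ → List A} {c : ℕ → ℕ} g k → (∀ m → length (f m) ≡ c m) →
                          length (concat (map f (applyUpTo g k))) ≡ ∑[ i < k ] c (g i)
length-concat-applyUpTo             g zero    _       = refl
length-concat-applyUpTo {f = f} {c} g (suc k) length≡ = begin
  length (f (g 0) ++ concat (map f (applyUpTo (λ i → g (suc i)) k)))
    ≡⟨ length-++ (f (g 0)) ⟩
  length (f (g 0)) + length (concat (map f (applyUpTo (λ i → g (suc i)) k)))
    ≡⟨ cong₂ _+_ (length≡ (g 0)) (length-concat-applyUpTo (λ i → g (suc i)) k length≡) ⟩
  c (g 0) + ∑[ i < k ] c (g (suc i))
    ≡⟨ sym (∑-head (λ i → c (g i)) k) ⟩
  ∑[ i < suc k ] c (g i) ∎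
  where open ≡-Reasoning

𝟙[_] : {A : Set} → Dec A → ℕ
𝟙[ yes _ ] = 1
𝟙[ no  _ ] = 0

length-filter-∷ : ∀ {P : ℕ → Set} (P? : ∀ n → Dec (P n)) x xs →
                  length (filter P? (x ∷ xs)) ≡ 𝟙[ P? x ] + length (filter P? xs)
length-filter-∷ P? x xs with P? x
... | yes _ = refl
... | no  _ = refl

length-filter-applyUpTo : ∀ {P : ℕ → Set} (P? : ∀ n → Dec (P n)) g k →
                          length (filter P? (applyUpTo g k)) ≡ ∑[ i < k ] 𝟙[ P? (g i) ]
length-filter-applyUpTo P? g zero    = refl
length-filter-applyUpTo P? g (suc k) =
  trans (length-filter-∷ P? (g 0) (applyUpTo (λ i → g (suc i)) k))
        (trans (cong (𝟙[ P? (g 0) ] +_) (length-filter-applyUpTo P? (λ i → g (suc i)) k))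
               (sym (∑-head (λ i → 𝟙[ P? (g i) ]) k)))

delay : {A : Set} → A → ℕ → (ℕ → A) → ℕ → A
delay z zero    f n       = f n
delay z (suc e) f zero    = z
delay z (suc e) f (suc n) = delay z e f n

module _ {A : Set} {z : A} where

  delay-below : ∀ {e n} (f : ℕ → A) → n < e → delay z e f n ≡ z
  delay-below {suc e} {zero}  f _         = refl
  delay-below {suc e} {suc n} f (s≤s n<e) = delay-below f n<e

  delay-≤ : ∀ {e n} (f : ℕ → A) → e ≤ n → delay z e f n ≡ f (n ∸ e)
  delay-≤ {zero}          f _         = refl
  delay-≤ {suc e} {suc n} f (s≤s e≤n) = delay-≤ f e≤n

  delay-at : ∀ e {n} (f : ℕ → A) → delay z e f (e + n) ≡ f n
  delay-at zero    f = refl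
  delay-at (suc e) f = delay-at e f

  delay-cancel : ∀ a {e n} (f : ℕ → A) → delay z (a + e) f (a + n) ≡ delay z e f n
  delay-cancel zero    f = refl
  delay-cancel (suc a) f = delay-cancel a f

  delay-local : ∀ e {n} {f g : ℕ → A} → (∀ i → i ≤ n → f i ≡ g i) → delay z e f n ≡ delay z e g n
  delay-local zero            f≡g = f≡g _ ≤-refl
  delay-local (suc e) {zero}  f≡g = refl
  delay-local (suc e) {suc n} f≡g = delay-local e (λ i i≤n → f≡g i (m≤n⇒m≤1+n i≤n))

  delay-delay : ∀ a b (f : ℕ → A) n → delay z a (delay z b f) n ≡ delay z (a + b) f n
  delay-delay zero    b f n       = refl
  delay-delay (suc a) b f zero    = refl
  delay-delay (suc a) b f (suc n) = delay-delay a b f n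

delay-map : ∀ {A B : Set} {z : A} {z′ : B} (g : A → B) → g z ≡ z′ →
            ∀ e (f : ℕ → A) n → g (delay z e f n) ≡ delay z′ e (λ i → g (f i)) n
delay-map g gz≡z′ zero    f n       = refl
delay-map g gz≡z′ (suc e) f zero    = gz≡z′
delay-map g gz≡z′ (suc e) f (suc n) = delay-map g gz≡z′ e f n

∑-delay : ∀ e N (f : ℕ → ℕ) → ∑[ n < N ] delay 0 e f n ≤ ∑< N f
∑-delay zero    N       f = ≤-refl
∑-delay (suc e) zero    f = z≤n
∑-delay (suc e) (suc N) f = begin
  ∑[ n < suc N ] delay 0 (suc e) f n   ≡⟨ ∑-head (delay 0 (suc e) f) N ⟩
  ∑[ n < N ] delay 0 e f n             ≤⟨ ∑-delay e N f ⟩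
  ∑< N f                               ≤⟨ ∑-monoˡ f (n≤1+n N) ⟩
  ∑< (suc N) f                         ∎
  where open ≤-Reasoning

-- Power series modulo 2

Series : Set
Series = ℕ → Parity

series : AbelianGroup 0ℓ 0ℓ
series = Pointwise.abelianGroup ℙ.+-0-abelianGroup

open AbelianGroup series
  using (_≈_; ∙-cong; assoc; comm; inverseʳ; identityˡ; setoid; commutativeSemigroup)
  renaming (_∙_ to _⊕_; ε to 𝟎; refl to ≈-refl; sym to ≈-sym; trans to ≈-trans; reflexive to ≈-reflexive)
open import Algebra.Properties.CommutativeSemigroup commutativeSemigroup
  using () renaming (interchange to ⊕-interchange; xy∙z≈zx∙y to ⊕-rotate)
module ≈-Reasoning = SetoidReasoning setoid

-- Addition is pointwise, so the unchanged summand cannot be inferred from the goal.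
⊕-congˡ : ∀ s {r r′} → r ≈ r′ → s ⊕ r ≈ s ⊕ r′
⊕-congˡ s r≈r′ = ∙-cong (≈-refl {s}) r≈r′

⊕-congʳ : ∀ {s s′} r → s ≈ s′ → s ⊕ r ≈ s′ ⊕ r
⊕-congʳ r s≈s′ = ∙-cong s≈s′ (≈-refl {r})

x⊕y≈z⇒x≈y⊕z : ∀ x y z → x ⊕ y ≈ z → x ≈ y ⊕ z
x⊕y≈z⇒x≈y⊕z x y z x⊕y≈z = begin
  x               ≈⟨ ≈-sym (identityˡ x) ⟩
  𝟎 ⊕ x           ≈⟨ ⊕-congʳ x (≈-sym (inverseʳ y)) ⟩
  (y ⊕ y) ⊕ x     ≈⟨ assoc y y x ⟩
  y ⊕ (y ⊕ x)     ≈⟨ ⊕-congˡ y (comm y x) ⟩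
  y ⊕ (x ⊕ y)     ≈⟨ ⊕-congˡ y x⊕y≈z ⟩
  y ⊕ z           ∎
  where open ≈-Reasoning

⊕-cancel-middle : ∀ x y z → (x ⊕ y) ⊕ (y ⊕ z) ≈ x ⊕ z
⊕-cancel-middle x y z = begin
  (x ⊕ y) ⊕ (y ⊕ z)   ≈⟨ assoc x y (y ⊕ z) ⟩
  x ⊕ (y ⊕ (y ⊕ z))   ≈⟨ ⊕-congˡ x (≈-sym (assoc y y z)) ⟩
  x ⊕ ((y ⊕ y) ⊕ z)   ≈⟨ ⊕-congˡ x (⊕-congʳ z (inverseʳ y)) ⟩
  x ⊕ (𝟎 ⊕ z)         ≈⟨ ⊕-congˡ x (identityˡ z) ⟩
  x ⊕ z               ∎
  where open ≈-Reasoning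

𝟙 : Series
𝟙 zero    = 1ℙ
𝟙 (suc _) = 0ℙ

infixr 8 q^_·_
q^_·_ : ℕ → Series → Series
q^ e · s = delay 0ℙ e s

q^-cong : ∀ e {s r} → s ≈ r → q^ e · s ≈ q^ e · r
q^-cong e s≈r n = delay-local e (λ i _ → s≈r i)

q^-⊕ : ∀ e s r → q^ e · (s ⊕ r) ≈ q^ e · s ⊕ q^ e · r
q^-⊕ zero    s r n       = refl
q^-⊕ (suc e) s r zero    = refl
q^-⊕ (suc e) s r (suc n) = q^-⊕ e s r n

q^-q^ : ∀ a b s → q^ a · q^ b · s ≈ q^ (a + b) · s
q^-q^ a b s = delay-delay a b s

q^-comm : ∀ a b s → q^ a · q^ b · s ≈ q^ b · q^ a · s
q^-comm a b s = ≈-trans (q^-q^ a b s) (≈-trans (≈-reflexive (cong (q^_· s) (+-comm a b))) (≈-sym (q^-q^ b a s)))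

infixr 8 1+q^_·_
1+q^_·_ : ℕ → Series → Series
1+q^ j · s = s ⊕ q^ j · s

1+q^-cong : ∀ j {s r} → s ≈ r → 1+q^ j · s ≈ 1+q^ j · r
1+q^-cong j s≈r = ∙-cong s≈r (q^-cong j s≈r)

1+q^0 : ∀ s → 1+q^ 0 · s ≈ 𝟎
1+q^0 = inverseʳ

q^-1+q^ : ∀ a b s → q^ a · 1+q^ b · s ≈ q^ a · s ⊕ q^ (a + b) · s
q^-1+q^ a b s = ≈-trans (q^-⊕ a s (q^ b · s)) (⊕-congˡ (q^ a · s) (q^-q^ a b s))

1+q^-comm : ∀ i j s → 1+q^ i · 1+q^ j · s ≈ 1+q^ j · 1+q^ i · s
1+q^-comm i j s = begin
  (s ⊕ q^ j · s) ⊕ q^ i · (s ⊕ q^ j · s)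
    ≈⟨ ⊕-congˡ (s ⊕ q^ j · s) (q^-⊕ i s (q^ j · s)) ⟩
  (s ⊕ q^ j · s) ⊕ (q^ i · s ⊕ q^ i · q^ j · s)
    ≈⟨ ⊕-interchange s (q^ j · s) (q^ i · s) (q^ i · q^ j · s) ⟩
  (s ⊕ q^ i · s) ⊕ (q^ j · s ⊕ q^ i · q^ j · s)
    ≈⟨ ⊕-congˡ (s ⊕ q^ i · s) (⊕-congˡ (q^ j · s) (q^-comm i j s)) ⟩
  (s ⊕ q^ i · s) ⊕ (q^ j · s ⊕ q^ j · q^ i · s)
    ≈⟨ ⊕-congˡ (s ⊕ q^ i · s) (≈-sym (q^-⊕ j s (q^ i · s))) ⟩
  (s ⊕ q^ i · s) ⊕ q^ j · (s ⊕ q^ i · s) ∎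
  where open ≈-Reasoning

∏1+q^ : ℕ → ℕ → Series → Series
∏1+q^ a zero    s = s
∏1+q^ a (suc m) s = 1+q^ a · ∏1+q^ (suc a) m s

∏-cong : ∀ a m {s r} → s ≈ r → ∏1+q^ a m s ≈ ∏1+q^ a m r
∏-cong a zero    s≈r = s≈r
∏-cong a (suc m) s≈r = 1+q^-cong a (∏-cong (suc a) m s≈r)

∏-1+q^ : ∀ a m j s → ∏1+q^ a m (1+q^ j · s) ≈ 1+q^ j · ∏1+q^ a m s
∏-1+q^ a zero    j s = ≈-refl
∏-1+q^ a (suc m) j s =
  ≈-trans (1+q^-cong a (∏-1+q^ (suc a) m j s)) (1+q^-comm a j (∏1+q^ (suc a) m s))

∏-snoc : ∀ a m s → ∏1+q^ a (suc m) s ≈ 1+q^ (a + m) · ∏1+q^ a m s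
∏-snoc a zero    s = ≈-reflexive (cong (1+q^_· s) (sym (+-identityʳ a)))
∏-snoc a (suc m) s = begin
  1+q^ a · ∏1+q^ (suc a) (suc m) s                ≈⟨ 1+q^-cong a (∏-snoc (suc a) m s) ⟩
  1+q^ a · 1+q^ (suc a + m) · ∏1+q^ (suc a) m s   ≈⟨ 1+q^-comm a (suc a + m) (∏1+q^ (suc a) m s) ⟩
  1+q^ (suc a + m) · 1+q^ a · ∏1+q^ (suc a) m s   ≡⟨ cong (1+q^_· ∏1+q^ a (suc m) s) (sym (+-suc a m)) ⟩
  1+q^ (a + suc m) · ∏1+q^ a (suc m) s            ∎
  where open ≈-Reasoning

SupportedOnMultiplesOf : ℕ → Series → Set
SupportedOnMultiplesOf t s = ∀ n → ¬ t ∣ n → s n ≡ 0ℙ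

supportedOnMultiplesOf-cong : ∀ {t s r} → s ≈ r → SupportedOnMultiplesOf t s → SupportedOnMultiplesOf t r
supportedOnMultiplesOf-cong s≈r s-supported n t∤n = trans (sym (s≈r n)) (s-supported n t∤n)

𝟙-supportedOnMultiplesOf : ∀ t → SupportedOnMultiplesOf t 𝟙
𝟙-supportedOnMultiplesOf t zero    t∤0 = ⊥-elim (t∤0 (divides 0 refl))
𝟙-supportedOnMultiplesOf t (suc n) _   = refl

1+q^-supportedOnMultiplesOf : ∀ {t J s} → t ∣ J →
                              SupportedOnMultiplesOf t s → SupportedOnMultiplesOf t (1+q^ J · s)
1+q^-supportedOnMultiplesOf {t} {J} {s} t∣J s-supported n t∤n with J ≤? n
... | yes J≤n = cong₂ ℙ._+_ (s-supported n t∤n) (trans (delay-≤ s J≤n) (s-supported (n ∸ J) t∤n∸J))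
  where
  t∤n∸J : ¬ t ∣ n ∸ J
  t∤n∸J t∣n∸J = t∤n (subst (t ∣_) (m+[n∸m]≡n J≤n) (∣m∣n⇒∣m+n t∣J t∣n∸J))
... | no  J≰n = cong₂ ℙ._+_ (s-supported n t∤n) (delay-below s (≰⇒> J≰n))

-- Euler's pentagonal number theorem modulo 2

triangle : ℕ → ℕ
triangle zero    = 0
triangle (suc n) = suc n + triangle n

-- ω⁻ m = m(3m - 1)/2 and ω⁺ m = m(3m + 1)/2, the generalized pentagonal numbers
ω⁻ ω⁺ : ℕ → ℕ
ω⁻ zero    = 0
ω⁻ (suc m) = triangle (suc m) + suc m * m
ω⁺ m       = triangle m + m * m

ω⁻-suc : ∀ m → ω⁻ (suc m) ≡ suc (ω⁺ m + (m + m))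
ω⁻-suc m = identity (triangle m) m
  where
  identity : ∀ T m → (suc m + T) + suc m * m ≡ suc ((T + m * m) + (m + m))
  identity = solve-∀

ω⁺-suc : ∀ m → ω⁺ (suc m) ≡ ω⁻ (suc m) + suc m
ω⁺-suc m = identity (triangle (suc m)) m
  where
  identity : ∀ T m → T + suc m * suc m ≡ (T + suc m * m) + suc m
  identity = solve-∀

ω⁺<ω⁻ : ∀ m → ω⁺ m < ω⁻ (suc m)
ω⁺<ω⁻ m = subst (ω⁺ m <_) (sym (ω⁻-suc m)) (s≤s (m≤m+n (ω⁺ m) (m + m)))

ω⁻≤ω⁺ : ∀ m → ω⁻ m ≤ ω⁺ m
ω⁻≤ω⁺ zero    = z≤n
ω⁻≤ω⁺ (suc m) = subst (ω⁻ (suc m) ≤_) (sym (ω⁺-suc m)) (m≤m+n (ω⁻ (suc m)) (suc m))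

ω⁻-strict : ∀ m → ω⁻ m < ω⁻ (suc m)
ω⁻-strict m = ≤-<-trans (ω⁻≤ω⁺ m) (ω⁺<ω⁻ m)

ω⁺-strict : ∀ m → ω⁺ m < ω⁺ (suc m)
ω⁺-strict m = <-≤-trans (ω⁺<ω⁻ m) (ω⁻≤ω⁺ (suc m))

ω⁻-mono : ∀ {m k} → m ≤ k → ω⁻ m ≤ ω⁻ k
ω⁻-mono = mono-from-steps ω⁻ (λ k → <⇒≤ (ω⁻-strict k))

m≤ω⁺ : ∀ m → m ≤ ω⁺ m
m≤ω⁺ zero    = z≤n
m≤ω⁺ (suc m) = ≤-trans (s≤s (m≤ω⁺ m)) (ω⁺-strict m)

pentagonalSum : ℕ → Series → Series
pentagonalSum zero    s = s
pentagonalSum (suc m) s = pentagonalSum m s ⊕ q^ ω⁻ (suc m) · s ⊕ q^ ω⁺ (suc m) · s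

-- (∑ q^ω) · s, where ω runs over all generalized pentagonal numbers: those above n do not
-- contribute to the coefficient of q^n.
pentagonalProduct : Series → Series
pentagonalProduct s n = pentagonalSum n s n

⨁≤ : ℕ → (ℕ → Series) → Series
⨁≤ zero    f = f 0
⨁≤ (suc n) f = ⨁≤ n f ⊕ f (suc n)

infix 10 ⨁≤
syntax ⨁≤ n (λ k → e) = ⨁[ k ≤ n ] e

⨁-cong : ∀ n {f g} → (∀ k → k ≤ n → f k ≈ g k) → ⨁≤ n f ≈ ⨁≤ n g
⨁-cong zero    f≈g = f≈g 0 z≤n
⨁-cong (suc n) f≈g = ∙-cong (⨁-cong n (λ k k≤n → f≈g k (m≤n⇒m≤1+n k≤n))) (f≈g (suc n) ≤-refl)

⨁-⊕ : ∀ n f g → ⨁≤ n f ⊕ ⨁≤ n g ≈ ⨁[ k ≤ n ] (f k ⊕ g k)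
⨁-⊕ zero    f g = ≈-refl
⨁-⊕ (suc n) f g = ≈-trans (⊕-interchange (⨁≤ n f) (f (suc n)) (⨁≤ n g) (g (suc n)))
                          (⊕-congʳ (f (suc n) ⊕ g (suc n)) (⨁-⊕ n f g))

⨁-telescope : ∀ n (G : ℕ → Series) → ⨁[ k ≤ n ] (G k ⊕ G (suc k)) ≈ G 0 ⊕ G (suc n)
⨁-telescope zero    G = ≈-refl
⨁-telescope (suc n) G = ≈-trans (⊕-congʳ (G (suc n) ⊕ G (suc (suc n))) (⨁-telescope n G))
                                (⊕-cancel-middle (G 0) (G (suc n)) (G (suc (suc n))))

⨁-head : ∀ n f i → (∀ k → k < n → f (suc k) i ≡ 0ℙ) → ⨁≤ n f i ≡ f 0 i
⨁-head zero    f i _     = refl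
⨁-head (suc n) f i later =
  trans (cong₂ ℙ._+_ (⨁-head n f i (λ k k<n → later k (m≤n⇒m≤1+n k<n))) (later n ≤-refl))
        (ℙ.+-identityʳ (f 0 i))

-- Shanks' proof: shanksSum n s starts (k = 0) with ∏1+q^ 1 n s, its other terms vanish below
-- q^(n+1), and shanksSum (n + 1) - shanksSum n telescopes (through shanksDiff) to the two new
-- pentagonal terms.
shanksTerm shanksDiff : ℕ → ℕ → Series → Series
shanksTerm n k s = q^ (triangle k + k * n) · ∏1+q^ (suc k) (n ∸ k) s
shanksDiff n k s = q^ (triangle k + k * n) · ∏1+q^ k (suc n ∸ k) s

shanksSum : ℕ → Series → Series
shanksSum n s = ⨁[ k ≤ n ] shanksTerm n k s

shanks-step : ∀ k r s → shanksTerm (suc (k + r)) k s ⊕ shanksTerm (k + r) k s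
                        ≈ shanksDiff (k + r) k s ⊕ shanksDiff (k + r) (suc k) s
shanks-step k r s = begin
  shanksTerm N k s ⊕ shanksTerm n k s
    ≈⟨ ∙-cong termN termn ⟩
  (q^ (a + k) · Q ⊕ q^ (a + k + N) · Q) ⊕ q^ a · Q
    ≈⟨ ⊕-rotate (q^ (a + k) · Q) (q^ (a + k + N) · Q) (q^ a · Q) ⟩
  (q^ a · Q ⊕ q^ (a + k) · Q) ⊕ q^ (a + k + N) · Q
    ≈⟨ ≈-sym (∙-cong diffk diffk+1) ⟩
  shanksDiff n k s ⊕ shanksDiff n (suc k) s ∎
  where
  open ≈-Reasoning
  n N a : ℕ
  n = k + r
  N = suc n
  a = triangle k + k * n
  Q : Series
  Q = ∏1+q^ (suc k) r s
  exponentN : ∀ T k r → T + k * suc (k + r) ≡ (T + k * (k + r)) + k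
  exponentN = solve-∀
  exponentDiff : ∀ T k r → (suc k + T) + suc k * (k + r) ≡ ((T + k * (k + r)) + k) + suc (k + r)
  exponentDiff = solve-∀
  n∸k≡r : n ∸ k ≡ r
  n∸k≡r = m+n∸m≡n k r
  N∸k≡1+r : N ∸ k ≡ suc r
  N∸k≡1+r = trans (+-∸-assoc 1 (m≤m+n k r)) (cong suc n∸k≡r)
  termN : shanksTerm N k s ≈ q^ (a + k) · Q ⊕ q^ (a + k + N) · Q
  termN = begin
    q^ (triangle k + k * N) · ∏1+q^ (suc k) (N ∸ k) s
      ≡⟨ cong₂ (λ e m → q^ e · ∏1+q^ (suc k) m s) (exponentN (triangle k) k r) N∸k≡1+r ⟩
    q^ (a + k) · ∏1+q^ (suc k) (suc r) s  ≈⟨ q^-cong (a + k) (∏-snoc (suc k) r s) ⟩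
    q^ (a + k) · 1+q^ N · Q               ≈⟨ q^-1+q^ (a + k) N Q ⟩
    q^ (a + k) · Q ⊕ q^ (a + k + N) · Q   ∎
  termn : shanksTerm n k s ≈ q^ a · Q
  termn = ≈-reflexive (cong (λ m → q^ a · ∏1+q^ (suc k) m s) n∸k≡r)
  diffk : shanksDiff n k s ≈ q^ a · Q ⊕ q^ (a + k) · Q
  diffk = ≈-trans (≈-reflexive (cong (λ m → q^ a · ∏1+q^ k m s) N∸k≡1+r)) (q^-1+q^ a k Q)
  diffk+1 : shanksDiff n (suc k) s ≈ q^ (a + k + N) · Q
  diffk+1 = ≈-reflexive (cong₂ (λ e m → q^ e · ∏1+q^ (suc k) m s) (exponentDiff (triangle k) k r) n∸k≡r)

shanksSum-suc : ∀ n s → shanksSum (suc n) s ≈ shanksSum n s ⊕ q^ ω⁻ (suc n) · s ⊕ q^ ω⁺ (suc n) · s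
shanksSum-suc n s =
  ∙-cong (x⊕y≈z⇒x≈y⊕z (⨁[ k ≤ n ] shanksTerm (suc n) k s) (shanksSum n s) (q^ ω⁻ (suc n) · s) telescoped)
         (emptyProduct (suc (suc n)) (ω⁺ (suc n)))
  where
  open ≈-Reasoning
  emptyProduct : ∀ a e → q^ e · ∏1+q^ a (n ∸ n) s ≈ q^ e · s
  emptyProduct a e = ≈-reflexive (cong (λ m → q^ e · ∏1+q^ a m s) (n∸n≡0 n))
  step : ∀ k → k ≤ n → shanksTerm (suc n) k s ⊕ shanksTerm n k s ≈ shanksDiff n k s ⊕ shanksDiff n (suc k) s
  step k k≤n = subst (λ n → shanksTerm (suc n) k s ⊕ shanksTerm n k s ≈ shanksDiff n k s ⊕ shanksDiff n (suc k) s)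
                     (m+[n∸m]≡n k≤n) (shanks-step k (n ∸ k) s)
  telescoped : ⨁[ k ≤ n ] shanksTerm (suc n) k s ⊕ shanksSum n s ≈ q^ ω⁻ (suc n) · s
  telescoped = begin
    ⨁[ k ≤ n ] shanksTerm (suc n) k s ⊕ ⨁[ k ≤ n ] shanksTerm n k s
      ≈⟨ ⨁-⊕ n (λ k → shanksTerm (suc n) k s) (λ k → shanksTerm n k s) ⟩
    ⨁[ k ≤ n ] (shanksTerm (suc n) k s ⊕ shanksTerm n k s)
      ≈⟨ ⨁-cong n step ⟩
    ⨁[ k ≤ n ] (shanksDiff n k s ⊕ shanksDiff n (suc k) s)
      ≈⟨ ⨁-telescope n (λ k → shanksDiff n k s) ⟩
    1+q^ 0 · ∏1+q^ 1 n s ⊕ shanksDiff n (suc n) s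
      ≈⟨ ⊕-congʳ (shanksDiff n (suc n) s) (1+q^0 (∏1+q^ 1 n s)) ⟩
    𝟎 ⊕ shanksDiff n (suc n) s
      ≈⟨ identityˡ (shanksDiff n (suc n) s) ⟩
    q^ ω⁻ (suc n) · ∏1+q^ (suc n) (n ∸ n) s
      ≈⟨ emptyProduct (suc n) (ω⁻ (suc n)) ⟩
    q^ ω⁻ (suc n) · s ∎

shanksSum≈pentagonalSum : ∀ n s → shanksSum n s ≈ pentagonalSum n s
shanksSum≈pentagonalSum zero    s = ≈-refl
shanksSum≈pentagonalSum (suc n) s =
  ≈-trans (shanksSum-suc n s)
          (⊕-congʳ (q^ ω⁺ (suc n) · s) (⊕-congʳ (q^ ω⁻ (suc n) · s) (shanksSum≈pentagonalSum n s)))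

pentagonal-number-theorem : ∀ n s i → i ≤ n → ∏1+q^ 1 n s i ≡ pentagonalSum n s i
pentagonal-number-theorem n s i i≤n =
  trans (sym (⨁-head n (λ k → shanksTerm n k s) i later)) (shanksSum≈pentagonalSum n s i)
  where
  i<exponent : ∀ k → i < triangle (suc k) + suc k * n
  i<exponent k = <-≤-trans (s≤s i≤n) (+-mono-≤ (s≤s (z≤n {k + triangle k})) (m≤m+n n (k * n)))
  later : ∀ k → k < n → shanksTerm n (suc k) s i ≡ 0ℙ
  later k _ = delay-below (∏1+q^ (suc (suc k)) (n ∸ suc k) s) (i<exponent k)

pentagonalSum-local : ∀ m {s r n} → (∀ i → i ≤ n → s i ≡ r i) → pentagonalSum m s n ≡ pentagonalSum m r n
pentagonalSum-local zero    s≡r = s≡r _ ≤-refl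
pentagonalSum-local (suc m) s≡r =
  cong₂ ℙ._+_ (cong₂ ℙ._+_ (pentagonalSum-local m s≡r) (delay-local (ω⁻ (suc m)) s≡r))
              (delay-local (ω⁺ (suc m)) s≡r)

pentagonalSum-truncate : ∀ s {m k n} → n < ω⁻ (suc m) → m ≤ k → pentagonalSum k s n ≡ pentagonalSum m s n
pentagonalSum-truncate s {m} {k} {n} n<ω⁻ m≤k = go (≤⇒≤′ m≤k)
  where
  go : ∀ {k} → m ≤′ k → pentagonalSum k s n ≡ pentagonalSum m s n
  go ≤′-refl                 = refl
  go {suc k} (≤′-step m≤′k) = begin
    pentagonalSum k s n ℙ.+ (q^ ω⁻ (suc k) · s) n ℙ.+ (q^ ω⁺ (suc k) · s) n
      ≡⟨ cong₂ ℙ._+_ (cong₂ ℙ._+_ (go m≤′k) (delay-below s below⁻)) (delay-below s below⁺) ⟩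
    pentagonalSum m s n ℙ.+ 0ℙ ℙ.+ 0ℙ
      ≡⟨ trans (ℙ.+-identityʳ _) (ℙ.+-identityʳ _) ⟩
    pentagonalSum m s n ∎
    where
    open ≡-Reasoning
    below⁻ : n < ω⁻ (suc k)
    below⁻ = <-≤-trans n<ω⁻ (ω⁻-mono (s≤s (≤′⇒≤ m≤′k)))
    below⁺ : n < ω⁺ (suc k)
    below⁺ = <-≤-trans below⁻ (ω⁻≤ω⁺ (suc k))

-- Partitions without parts divisible by t

count : ℕ → ℕ → ℕ → ℕ
count t k n = length (partsUpTo t k n)

-- The m-th block of partsUpTo t (1 + j) n holds the partitions with m parts equal to 1 + j.
-- These blocks come from a local function of partsUpTo that cannot be named here, so the
-- left-hand side of block-length is left to unification with its use in count-unfold.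
mutual
  count-unfold : ∀ t j n → ¬ t ∣ suc j →
                 count t (suc j) n ≡ count t j n + ∑[ m < n ] delay 0 (suc m * suc j) (count t j) n
  count-unfold t j n t∤1+j with t ∣? suc j
  ... | yes t∣1+j = ⊥-elim (t∤1+j t∣1+j)
  ... | no  t∤1+j = trans (length-++ (map (replicate 0 (suc j) ++_) (partsUpTo t j n)))
                          (cong₂ _+_ (length-map (replicate 0 (suc j) ++_) (partsUpTo t j n))
                                     (length-concat-applyUpTo suc n (block-length t j n t∤1+j)))

  block-length : ∀ t j n (t∤1+j : ¬ t ∣ suc j) m → _ ≡ delay 0 (m * suc j) (count t j) n
  block-length t j n _ m with m * suc j ≤? n
  ... | yes fits  = trans (length-map _ (partsUpTo t j (n ∸ m * suc j))) (sym (delay-≤ (count t j) fits))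
  ... | no  ¬fits = sym (delay-below (count t j) (≰⇒> ¬fits))

∑-delay-multiples : ∀ j (f : ℕ → ℕ) n →
  ∑[ m < n ] delay 0 (suc m * suc j) f n ≡ delay 0 (suc j) (λ n′ → ∑[ m < suc n′ ] delay 0 (m * suc j) f n′) n
∑-delay-multiples j f n with suc j ≤? n
... | no  1+j≰n = trans (∑-zero n (λ m _ → delay-below f (<-≤-trans (≰⇒> 1+j≰n) (m≤m+n (suc j) (m * suc j)))))
                        (sym (delay-below _ (≰⇒> 1+j≰n)))
... | yes 1+j≤n = subst (λ n → ∑[ m < n ] delay 0 (suc m * suc j) f n ≡ delay 0 (suc j) g n)
                        (m+[n∸m]≡n 1+j≤n) (shifted (n ∸ suc j))
  where
  g : ℕ → ℕ
  g n′ = ∑[ m < suc n′ ] delay 0 (m * suc j) f n′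
  beyond : ∀ n′ i → n′ < (suc n′ + i) * suc j
  beyond n′ i = <-≤-trans (s≤s (m≤m+n n′ i)) (m≤m*n (suc n′ + i) (suc j))
  shifted : ∀ n′ → ∑[ m < suc j + n′ ] delay 0 (suc m * suc j) f (suc j + n′) ≡ delay 0 (suc j) g (suc j + n′)
  shifted n′ = begin
    ∑[ m < suc j + n′ ] delay 0 (suc m * suc j) f (suc j + n′)
      ≡⟨ ∑-cong (suc j + n′) (λ m _ → delay-cancel (suc j) f) ⟩
    ∑[ m < suc j + n′ ] delay 0 (m * suc j) f n′
      ≡⟨ cong (λ k → ∑[ m < k ] delay 0 (m * suc j) f n′) (cong suc (+-comm j n′)) ⟩
    ∑[ m < suc n′ + j ] delay 0 (m * suc j) f n′
      ≡⟨ ∑-split (λ m → delay 0 (m * suc j) f n′) (suc n′) j ⟩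
    g n′ + ∑[ i < j ] delay 0 ((suc n′ + i) * suc j) f n′
      ≡⟨ cong (g n′ +_) (∑-zero j (λ i _ → delay-below f (beyond n′ i))) ⟩
    g n′ + 0
      ≡⟨ +-identityʳ (g n′) ⟩
    g n′
      ≡⟨ sym (delay-at (suc j) g) ⟩
    delay 0 (suc j) g (suc j + n′) ∎
    where open ≡-Reasoning

count-divisible : ∀ t j → t ∣ suc j → ∀ n → count t (suc j) n ≡ count t j n
count-divisible t j t∣1+j n with t ∣? suc j
... | yes _      = refl
... | no  t∤1+j = ⊥-elim (t∤1+j t∣1+j)

count-recurrence : ∀ t j → ¬ t ∣ suc j → ∀ n →
                   count t (suc j) n ≡ count t j n + delay 0 (suc j) (count t (suc j)) n
count-recurrence t j t∤1+j n = begin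
  count t (suc j) n
    ≡⟨ count-unfold t j n t∤1+j ⟩
  count t j n + ∑[ m < n ] delay 0 (suc m * suc j) (count t j) n
    ≡⟨ cong (count t j n +_) (∑-delay-multiples j (count t j) n) ⟩
  count t j n + delay 0 (suc j) (λ n′ → ∑[ m < suc n′ ] delay 0 (m * suc j) (count t j) n′) n
    ≡⟨ cong (count t j n +_) (delay-local {z = 0} (suc j) {n} (λ n′ _ → refold n′)) ⟩
  count t j n + delay 0 (suc j) (count t (suc j)) n ∎
  where
  open ≡-Reasoning
  refold : ∀ n′ → ∑[ m < suc n′ ] delay 0 (m * suc j) (count t j) n′ ≡ count t (suc j) n′
  refold n′ = trans (∑-head (λ m → delay 0 (m * suc j) (count t j) n′) n′) (sym (count-unfold t j n′ t∤1+j))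

count-small : ∀ t j n → n < suc j → count t (suc j) n ≡ count t j n
count-small t j n n<1+j = byDivisibility (t ∣? suc j)
  where
  byDivisibility : Dec (t ∣ suc j) → count t (suc j) n ≡ count t j n
  byDivisibility (yes t∣1+j) = count-divisible t j t∣1+j n
  byDivisibility (no  t∤1+j) =
    trans (count-recurrence t j t∤1+j n)
          (trans (cong (count t j n +_) (delay-below (count t (suc j)) n<1+j)) (+-identityʳ _))

count-stable : ∀ t {k n} → n ≤ k → count t k n ≡ b t n
count-stable t {k} {n} n≤k = go (≤⇒≤′ n≤k)
  where
  go : ∀ {k} → n ≤′ k → count t k n ≡ b t n
  go ≤′-refl         = refl
  go (≤′-step n≤′k) = trans (count-small t _ n (s≤s (≤′⇒≤ n≤′k))) (go n≤′k)

partitionParity : ℕ → ℕ → Series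
partitionParity t k n = parity (count t k n)

partitionParity-zero : ∀ t → partitionParity t 0 ≈ 𝟙
partitionParity-zero t zero    = refl
partitionParity-zero t (suc n) = refl

partitionParity-divisible : ∀ t j → t ∣ suc j → partitionParity t (suc j) ≈ partitionParity t j
partitionParity-divisible t j t∣1+j n = cong parity (count-divisible t j t∣1+j n)

partitionParity-recurrence : ∀ t j → ¬ t ∣ suc j → 1+q^ (suc j) · partitionParity t (suc j) ≈ partitionParity t j
partitionParity-recurrence t j t∤1+j =
  ≈-sym (≈-trans (x⊕y≈z⇒x≈y⊕z (partitionParity t j) D B (≈-sym unfolded)) (comm D B))
  where
  B D : Series
  B = partitionParity t (suc j)
  D = q^ (suc j) · B
  unfolded : B ≈ partitionParity t j ⊕ D
  unfolded n = trans (cong parity (count-recurrence t j t∤1+j n))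
                     (trans (ℙ.+-homo-+ (count t j n) _)
                            (cong (partitionParity t j n ℙ.+_) (delay-map parity refl (suc j) (count t (suc j)) n)))

∏-partitionParity-supportedOnMultiplesOf : ∀ t k → SupportedOnMultiplesOf t (∏1+q^ 1 k (partitionParity t k))
∏-partitionParity-supportedOnMultiplesOf t zero    =
  supportedOnMultiplesOf-cong (≈-sym (partitionParity-zero t)) (𝟙-supportedOnMultiplesOf t)
∏-partitionParity-supportedOnMultiplesOf t (suc j) = byDivisibility (t ∣? suc j)
  where
  B : Series
  B = partitionParity t (suc j)
  byDivisibility : Dec (t ∣ suc j) → SupportedOnMultiplesOf t (∏1+q^ 1 (suc j) B)
  byDivisibility (yes t∣1+j) = supportedOnMultiplesOf-cong (≈-sym peeled)
    (1+q^-supportedOnMultiplesOf t∣1+j (∏-partitionParity-supportedOnMultiplesOf t j))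
    where
    peeled : ∏1+q^ 1 (suc j) B ≈ 1+q^ (suc j) · ∏1+q^ 1 j (partitionParity t j)
    peeled = ≈-trans (∏-snoc 1 j B) (1+q^-cong (suc j) (∏-cong 1 j (partitionParity-divisible t j t∣1+j)))
  byDivisibility (no  t∤1+j) = supportedOnMultiplesOf-cong (≈-sym absorbed)
    (∏-partitionParity-supportedOnMultiplesOf t j)
    where
    absorbed : ∏1+q^ 1 (suc j) B ≈ ∏1+q^ 1 j (partitionParity t j)
    absorbed = ≈-trans (∏-snoc 1 j B)
               (≈-trans (≈-sym (∏-1+q^ 1 j (suc j) B)) (∏-cong 1 j (partitionParity-recurrence t j t∤1+j)))

bParity : ℕ → Series
bParity t n = parity (b t n)

pentagonalProduct-bParity : ∀ t → SupportedOnMultiplesOf t (pentagonalProduct (bParity t))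
pentagonalProduct-bParity t n t∤n = begin
  pentagonalSum n (bParity t) n            ≡⟨ pentagonalSum-local n (λ i i≤n → cong parity (sym (count-stable t i≤n))) ⟩
  pentagonalSum n (partitionParity t n) n  ≡⟨ sym (pentagonal-number-theorem n (partitionParity t n) n ≤-refl) ⟩
  ∏1+q^ 1 n (partitionParity t n) n        ≡⟨ ∏-partitionParity-supportedOnMultiplesOf t n n t∤n ⟩
  0ℙ                                       ∎
  where open ≡-Reasoning

-- Counting vanishing coefficients

zeroIndicator : Series → ℕ → ℕ
zeroIndicator s i = 𝟙[ s i ℙ.≟ 0ℙ ]

zeroIndicator≡0 : ∀ s i → zeroIndicator s i ≡ 0 → s i ≡ 1ℙ
zeroIndicator≡0 s i with s i
... | 1ℙ = λ _ → refl

zeroCount : Series → ℕ → ℕ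
zeroCount s N = ∑< N (zeroIndicator s)

pentagonalZeros : ℕ → Series → ℕ → ℕ
pentagonalZeros zero    s n = zeroIndicator s n
pentagonalZeros (suc m) s n =
  pentagonalZeros m s n + delay 0 (ω⁻ (suc m)) (zeroIndicator s) n + delay 0 (ω⁺ (suc m)) (zeroIndicator s) n

pentagonalSum-odd : ∀ m s {n} → ω⁺ m ≤ n → pentagonalZeros m s n ≡ 0 → pentagonalSum m s n ≡ 1ℙ
pentagonalSum-odd zero    s _    none = zeroIndicator≡0 s _ none
pentagonalSum-odd (suc m) s {n} ω⁺≤n none =
  cong₂ ℙ._+_ (cong₂ ℙ._+_ (pentagonalSum-odd m s (≤-trans (<⇒≤ (ω⁺-strict m)) ω⁺≤n) (m+n≡0⇒m≡0 Z noneZA))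
                           (termOdd (ω⁻ (suc m)) (≤-trans (ω⁻≤ω⁺ (suc m)) ω⁺≤n) (m+n≡0⇒n≡0 Z noneZA)))
              (termOdd (ω⁺ (suc m)) ω⁺≤n (m+n≡0⇒n≡0 (Z + A) none))
  where
  Z A : ℕ
  Z = pentagonalZeros m s n
  A = delay 0 (ω⁻ (suc m)) (zeroIndicator s) n
  noneZA : Z + A ≡ 0
  noneZA = m+n≡0⇒m≡0 (Z + A) none
  termOdd : ∀ e → e ≤ n → delay 0 e (zeroIndicator s) n ≡ 0 → (q^ e · s) n ≡ 1ℙ
  termOdd e e≤n none =
    trans (delay-≤ s e≤n) (zeroIndicator≡0 s (n ∸ e) (trans (sym (delay-≤ (zeroIndicator s) e≤n)) none))

pentagonalZeros-mono : ∀ s n {m K} → m ≤ K → pentagonalZeros m s n ≤ pentagonalZeros K s n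
pentagonalZeros-mono s n = mono-from-steps (λ K → pentagonalZeros K s n) (λ K → ≤-trans (m≤m+n _ _) (m≤m+n _ _))

pentagonalZeros-positive : ∀ {t s} m {n} → SupportedOnMultiplesOf t (pentagonalProduct s) → ¬ t ∣ n →
                           ω⁺ m ≤ n → n < ω⁻ (suc m) → 1 ≤ pentagonalZeros m s n
pentagonalZeros-positive {t} {s} m {n} supported t∤n ω⁺≤n n<ω⁻ = positive (pentagonalZeros m s n) refl
  where
  sum≡0 : pentagonalSum m s n ≡ 0ℙ
  sum≡0 = trans (sym (pentagonalSum-truncate s n<ω⁻ (≤-trans (m≤ω⁺ m) ω⁺≤n))) (supported n t∤n)
  positive : ∀ z → pentagonalZeros m s n ≡ z → 1 ≤ z
  positive zero    none = ⊥-elim (ℙ.p≢p⁻¹ 0ℙ (trans (sym sum≡0) (pentagonalSum-odd m s ω⁺≤n none)))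
  positive (suc _) _    = s≤s z≤n

nonMultiple : ℕ → ℕ → ℕ
nonMultiple t n = 𝟙[ ¬? (t ∣? n) ]

nonMultiple-pair : ∀ {t} → 2 ≤ t → ∀ x → 1 ≤ nonMultiple t x + nonMultiple t (suc x)
nonMultiple-pair {t} 2≤t x = pair (t ∣? x) (t ∣? suc x)
  where
  pair : (d : Dec (t ∣ x)) (d′ : Dec (t ∣ suc x)) → 1 ≤ 𝟙[ ¬? d ] + 𝟙[ ¬? d′ ]
  pair (yes t∣x) (yes t∣1+x) =
    ⊥-elim (<⇒≱ 2≤t (≤-reflexive (∣1⇒≡1 (∣m+n∣m⇒∣n (subst (t ∣_) (+-comm 1 x) t∣1+x) t∣x))))
  pair (yes _)   (no _)      = s≤s z≤n
  pair (no _)    _           = s≤s z≤n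

nonMultiple-run : ∀ {t} → 2 ≤ t → ∀ a j → j ≤ ∑[ i < j + j ] nonMultiple t (a + i)
nonMultiple-run     2≤t a zero    = z≤n
nonMultiple-run {t} 2≤t a (suc j) = begin
  suc j
    ≡⟨ +-comm 1 j ⟩
  j + 1
    ≤⟨ +-mono-≤ (nonMultiple-run 2≤t a j) (nonMultiple-pair 2≤t (a + (j + j))) ⟩
  ∑[ i < j + j ] f i + (f (j + j) + nonMultiple t (suc (a + (j + j))))
    ≡⟨ sym (+-assoc (∑[ i < j + j ] f i) (f (j + j)) _) ⟩
  ∑[ i < suc (j + j) ] f i + nonMultiple t (suc (a + (j + j)))
    ≡⟨ cong (λ x → ∑[ i < suc (j + j) ] f i + nonMultiple t x) (sym (+-suc a (j + j))) ⟩
  ∑[ i < suc (suc (j + j)) ] f i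
    ≡⟨ cong (λ k → ∑[ i < suc k ] f i) (sym (+-suc j j)) ⟩
  ∑[ i < suc j + suc j ] f i ∎
  where
  open ≤-Reasoning
  f : ℕ → ℕ
  f i = nonMultiple t (a + i)

nonMultiple≤pentagonalZeros : ∀ {t s m K n} → SupportedOnMultiplesOf t (pentagonalProduct s) → m ≤ K →
                              ω⁺ m ≤ n → n < ω⁻ (suc m) → nonMultiple t n ≤ pentagonalZeros K s n
nonMultiple≤pentagonalZeros {t} {s} {m} {K} {n} supported m≤K ω⁺≤n n<ω⁻ = byDivisibility (t ∣? n)
  where
  byDivisibility : (d : Dec (t ∣ n)) → 𝟙[ ¬? d ] ≤ pentagonalZeros K s n
  byDivisibility (yes _)   = z≤n
  byDivisibility (no  t∤n) =
    ≤-trans (pentagonalZeros-positive m supported t∤n ω⁺≤n n<ω⁻) (pentagonalZeros-mono s n m≤K)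

pentagonalZeros-lower : ∀ {t s K} → 2 ≤ t → SupportedOnMultiplesOf t (pentagonalProduct s) →
                        ∀ m → m ≤ K → triangle m ≤ ∑[ n < ω⁻ (suc m) ] pentagonalZeros K s n
pentagonalZeros-lower 2≤t supported zero    _ = z≤n
pentagonalZeros-lower {t} {s} {K} 2≤t supported (suc m) 1+m≤K = begin
  suc m + triangle m
    ≡⟨ +-comm (suc m) (triangle m) ⟩
  triangle m + suc m
    ≤⟨ +-mono-≤ earlierWindows lastWindow ⟩
  ∑< a Z + ∑[ i < suc m + suc m ] Z (a + i)
    ≡⟨ sym (∑-split Z a (suc m + suc m)) ⟩
  ∑< (a + (suc m + suc m)) Z
    ≤⟨ ∑-monoˡ Z (≤-trans (n≤1+n _) (≤-reflexive (sym (ω⁻-suc (suc m))))) ⟩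
  ∑< (ω⁻ (suc (suc m))) Z ∎
  where
  open ≤-Reasoning
  a : ℕ
  a = ω⁺ (suc m)
  Z : ℕ → ℕ
  Z n = pentagonalZeros K s n
  earlierWindows : triangle m ≤ ∑< a Z
  earlierWindows =
    ≤-trans (pentagonalZeros-lower 2≤t supported m (≤-trans (n≤1+n m) 1+m≤K)) (∑-monoˡ Z (ω⁻≤ω⁺ (suc m)))
  inWindow : ∀ i → i < suc m + suc m → nonMultiple t (a + i) ≤ Z (a + i)
  inWindow i i<2m+2 = nonMultiple≤pentagonalZeros supported 1+m≤K (m≤m+n a i)
    (subst (a + i <_) (sym (ω⁻-suc (suc m))) (s≤s (+-monoʳ-≤ a (<⇒≤ i<2m+2))))
  lastWindow : suc m ≤ ∑[ i < suc m + suc m ] Z (a + i)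
  lastWindow = ≤-trans (nonMultiple-run 2≤t a (suc m)) (∑-mono (suc m + suc m) inWindow)

pentagonalZeros-upper : ∀ s K N → ∑[ n < N ] pentagonalZeros K s n ≤ (1 + 2 * K) * zeroCount s N
pentagonalZeros-upper s zero    N = ≤-reflexive (sym (*-identityˡ (zeroCount s N)))
pentagonalZeros-upper s (suc K) N = begin
  ∑[ n < N ] (P n + A n + B n)
    ≡⟨ ∑-+ (λ n → P n + A n) B N ⟩
  ∑[ n < N ] (P n + A n) + ∑< N B
    ≡⟨ cong (_+ ∑< N B) (∑-+ P A N) ⟩
  ∑< N P + ∑< N A + ∑< N B
    ≤⟨ +-mono-≤ (+-mono-≤ (pentagonalZeros-upper s K N) (∑-delay (ω⁻ (suc K)) N (zeroIndicator s)))
                (∑-delay (ω⁺ (suc K)) N (zeroIndicator s)) ⟩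
  (1 + 2 * K) * Z + Z + Z
    ≡⟨ regroup K Z ⟩
  (1 + 2 * suc K) * Z ∎
  where
  open ≤-Reasoning
  Z : ℕ
  Z = zeroCount s N
  P A B : ℕ → ℕ
  P n = pentagonalZeros K s n
  A n = delay 0 (ω⁻ (suc K)) (zeroIndicator s) n
  B n = delay 0 (ω⁺ (suc K)) (zeroIndicator s) n
  regroup : ∀ K Z → (1 + 2 * K) * Z + Z + Z ≡ (1 + 2 * suc K) * Z
  regroup = solve-∀

bracket : (f : ℕ → ℕ) → (∀ k → f k < f (suc k)) → ∀ x → f 0 ≤ x → ∃ λ K → f K ≤ x × x < f (suc K)
bracket f strict zero    f0≤0 = 0 , f0≤0 , ≤-<-trans z≤n (strict 0)
bracket f strict (suc x) f0≤1+x with f 0 ≤? x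
... | no  f0≰x = 0 , f0≤1+x , ≤-<-trans (≰⇒> f0≰x) (strict 0)
... | yes f0≤x with bracket f strict x f0≤x
...   | K , fK≤x , x<fK+1 with suc x <? f (suc K)
...     | yes 1+x<fK+1 = K , m≤n⇒m≤1+n fK≤x , 1+x<fK+1
...     | no  1+x≮fK+1 = suc K , ≮⇒≥ 1+x≮fK+1 , ≤-<-trans x<fK+1 (strict (suc K))

triangle-double : ∀ n → 2 * triangle n ≡ n * suc n
triangle-double zero    = refl
triangle-double (suc n) = begin
  2 * (suc n + triangle n)    ≡⟨ distribute n (triangle n) ⟩
  2 * suc n + 2 * triangle n  ≡⟨ cong (2 * suc n +_) (triangle-double n) ⟩
  2 * suc n + n * suc n       ≡⟨ collect n ⟩
  suc n * suc (suc n)         ∎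
  where
  open ≡-Reasoning
  distribute : ∀ n T → 2 * (suc n + T) ≡ 2 * suc n + 2 * T
  distribute = solve-∀
  collect : ∀ n → 2 * suc n + n * suc n ≡ suc n * suc (suc n)
  collect = solve-∀

triangle≤square : ∀ n → triangle n ≤ n * n
triangle≤square zero    = z≤n
triangle≤square (suc n) = +-monoʳ-≤ (suc n) (≤-trans (triangle≤square n) (*-monoʳ-≤ n (n≤1+n n)))

ω⁻≤2square : ∀ n → ω⁻ (suc n) ≤ 2 * (suc n * suc n)
ω⁻≤2square n = begin
  triangle (suc n) + suc n * n    ≤⟨ +-mono-≤ (triangle≤square (suc n)) (*-monoʳ-≤ (suc n) (n≤1+n n)) ⟩
  suc n * suc n + suc n * suc n   ≡⟨ sym (cong (suc n * suc n +_) (+-identityʳ (suc n * suc n))) ⟩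
  2 * (suc n * suc n)             ∎
  where open ≤-Reasoning

-- K(K + 1)/2 ≤ (2K + 1) Z gives K ≤ 4Z, and then X < ω⁻ (K + 2) ≤ 2(K + 2)² ≤ 72 Z².
square-bound : ∀ X K Z → 4 ≤ X → suc X < ω⁻ (suc (suc K)) → triangle K ≤ (1 + 2 * K) * Z → X ≤ 81 * (Z * Z)
square-bound X zero    Z 4≤X X<ω⁻ _ = ⊥-elim (<⇒≱ X<ω⁻ (s≤s 4≤X))
square-bound X (suc k) Z 4≤X X<ω⁻ triangle≤ = begin
  X                                ≤⟨ ≤-trans (n≤1+n X) (<⇒≤ X<ω⁻) ⟩
  ω⁻ (suc (suc K))                 ≤⟨ ω⁻≤2square (suc K) ⟩
  2 * (suc (suc K) * suc (suc K))  ≤⟨ *-monoʳ-≤ 2 (*-mono-≤ K+2≤6Z K+2≤6Z) ⟩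
  2 * ((6 * Z) * (6 * Z))          ≡⟨ seventyTwo Z ⟩
  72 * (Z * Z)                     ≤⟨ *-monoˡ-≤ (Z * Z) (m≤m+n 72 9) ⟩
  81 * (Z * Z)                     ∎
  where
  open ≤-Reasoning
  regroup : ∀ K Z → 2 * ((1 + 2 * K) * Z) + 2 * Z ≡ 4 * Z * suc K
  regroup = solve-∀
  six : ∀ Z → 2 * Z + 4 * Z ≡ 6 * Z
  six = solve-∀
  seventyTwo : ∀ Z → 2 * ((6 * Z) * (6 * Z)) ≡ 72 * (Z * Z)
  seventyTwo = solve-∀
  K : ℕ
  K = suc k
  K≤4Z : K ≤ 4 * Z
  K≤4Z = *-cancelʳ-≤ K (4 * Z) (suc K) (begin
    K * suc K                      ≡⟨ sym (triangle-double K) ⟩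
    2 * triangle K                 ≤⟨ *-monoʳ-≤ 2 triangle≤ ⟩
    2 * ((1 + 2 * K) * Z)          ≤⟨ m≤m+n _ (2 * Z) ⟩
    2 * ((1 + 2 * K) * Z) + 2 * Z  ≡⟨ regroup K Z ⟩
    4 * Z * suc K                  ∎)
  1≤Z : ∀ Z → K ≤ 4 * Z → 1 ≤ Z
  1≤Z zero    ()
  1≤Z (suc _) _ = s≤s z≤n
  K+2≤6Z : suc (suc K) ≤ 6 * Z
  K+2≤6Z = ≤-trans (+-mono-≤ (*-monoʳ-≤ 2 (1≤Z Z K≤4Z)) K≤4Z) (≤-reflexive (six Z))

zeroCount-lower-bound : ∀ {t s} → 2 ≤ t → SupportedOnMultiplesOf t (pentagonalProduct s) →
                        ∀ X → 4 ≤ X → X ≤ 81 * (zeroCount s (suc X) * zeroCount s (suc X))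
zeroCount-lower-bound {t} {s} 2≤t supported X 4≤X
  with bracket (λ k → ω⁻ (suc k)) (λ k → ω⁻-strict (suc k)) (suc X) (s≤s z≤n)
... | K , ω⁻≤1+X , 1+X<ω⁻ = square-bound X K (zeroCount s (suc X)) 4≤X 1+X<ω⁻ (begin
  triangle K                                 ≤⟨ pentagonalZeros-lower 2≤t supported K ≤-refl ⟩
  ∑[ n < ω⁻ (suc K) ] pentagonalZeros K s n  ≤⟨ ∑-monoˡ (λ n → pentagonalZeros K s n) ω⁻≤1+X ⟩
  ∑[ n < suc X ] pentagonalZeros K s n       ≤⟨ pentagonalZeros-upper s K (suc X) ⟩
  (1 + 2 * K) * zeroCount s (suc X)          ∎)
  where open ≤-Reasoning

even-indicator : ∀ m → 𝟙[ m % 2 ≟ 0 ] ≡ 𝟙[ parity m ℙ.≟ 0ℙ ]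
even-indicator zero          = refl
even-indicator (suc zero)    = refl
even-indicator (suc (suc m)) = even-indicator m

evenCount≡zeroCount : ∀ t X → evenCount t X ≡ zeroCount (bParity t) (suc X)
evenCount≡zeroCount t X =
  trans (length-filter-applyUpTo (λ n → b t n % 2 ≟ 0) (λ n → n) (suc X))
        (∑-cong (suc X) (λ n _ → even-indicator (b t n)))

theorem1p11 : (t : ℕ) → (t ≡ 6 ⊎ t ≡ 10) →
    ∃ λ B → ∃ λ X₀ → (X : ℕ) → X₀ ≤ X →
      X ≤ (suc B * suc B) * (evenCount t X * evenCount t X)
theorem1p11 t t≡6⊎t≡10 = 8 , 4 , λ X 4≤X →
  subst (λ E → X ≤ 81 * (E * E)) (sym (evenCount≡zeroCount t X))
        (zeroCount-lower-bound (2≤t t≡6⊎t≡10) (pentagonalProduct-bParity t) X 4≤X)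
  where
  2≤t : t ≡ 6 ⊎ t ≡ 10 → 2 ≤ t
  2≤t (inj₁ refl) = s≤s (s≤s z≤n)
  2≤t (inj₂ refl) = s≤s (s≤s z≤n)
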